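{- Let $C$ be a maximal chain in an interval $[u,w]$ of $P^*$ and let $L'$ be a consistent permutation of $L(C)$. If $C'$ is the chain specified by $L'$, then $L(C')\le_{\mathrm{lex}} L'$, and $C'$ ends at $u$.
   Context: $P$ is a poset with natural labeling $\ell$ (an injection $\ell:P\to\mathbb{Z}_{>0}$ with $a<b$ implying $\ell(a)<\ell(b)$, and $\ell(0)=0$), and $P_0$ ($P$ with new bottom $0$, order $\le_0$, cover relation $\gtrdot_0$) is locally finite. $P^*$ is the set of finite words over $P$ with generalized subword order: $u\le w$ iff there are indices $i_1<\dots<i_k$, $k=|u|$, with $u(j)\le_P w(i_j)$. An embedding of $u$ in $w$ is a word $\eta$ over $P_0$ of length $|w|$ whose nonzero letters in order form $u$ with $\eta(j)\le_0 w(j)$ for all $j$; the rightmost embedding is the one in which every letter occurrence of $u$ sits as far right as in any embedding. If $w$ covers $v$ in $P^*$, $v$ arises by replacing one letter $w(j)$ by some $a$ with $w(j)\gtrdot_0 a$ (deleting it if $a=0$); associate to the cover the rightmost embedding of $v$ in $w$. For a maximal chain $C: w=v_0\gtrdot\cdots\gtrdot v_n=u$ these compose to embeddings $\eta_i$ of $v_i$ in $w$; the $i$-th label is $\langle j_i,x_i\rangle$ with $j_i$ the position where $\eta_{i-1},\eta_i$ differ and $x_i=\eta_i(j_i)$; $L(C)$ is the sequence of labels. Labels are ordered by $\langle j,x\rangle<\langle k,y\rangle$ iff $j<k$ or ($j=k$ and $\ell(x)<\ell(y)$), and $\le_{\mathrm{lex}}$ is the induced lexicographic order on label sequences. A permutation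 $L'$ of the labels of $L(C)$ is consistent if for every index $i$ the labels of the form $\langle i,x\rangle$ occur in $L'$ in the same order as in $L(C)$. Starting from $w$ and successively setting position $j$ to $x$ for each label $\langle j,x\rangle$ of $L'$ gives a sequence of embeddings in $w$ (not necessarily rightmost); deleting zeros gives words forming a maximal chain $C'$ of $P^*$ starting at $w$, called the chain specified by $L'$. -}

module Defs where

open import Data.Nat using (ℕ; zero; suc; _<_; _≤_; _≟_)
open import Data.Maybe using (Maybe; just; nothing)
open import Data.List using (List; []; _∷_; map; filter)
open import Data.Product using (_×_; _,_; ∃; Σ; proj₁)
open import Data.Sum using (_⊎_)
open import Relation.Binary.PropositionalEquality using (_≡_; _≢_)
open import Relation.Nullary using (¬_)
open import Data.List.Relation.Binary.Sublist.Heterogeneous using (Sublist)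
open import Data.List.Relation.Binary.Pointwise using (Pointwise)
open import Data.List.Relation.Binary.Permutation.Propositional using (_↭_)
open import Data.List.Membership.Propositional using (_∈_)

module Setup {A : Set} (_≼_ : A → A → Set) (ℓ : A → ℕ) where

  _≺_ : A → A → Set
  a ≺ b = a ≼ b × a ≢ b

  NaturalLabeling : Set
  NaturalLabeling =
    (∀ a → 0 < ℓ a) × (∀ a b → ℓ a ≡ ℓ b → a ≡ b) × (∀ a b → a ≺ b → ℓ a < ℓ b)

  -- P₀ = P with a new bottom element 0 (= nothing)
  P₀ : Set
  P₀ = Maybe A

  data _≤₀_ : P₀ → P₀ → Set where
    0≤ : ∀ {x} → nothing ≤₀ x
    j≤ : ∀ {a b} → a ≼ b → just a ≤₀ just b

  LocallyFinite : Set
  LocallyFinite = ∀ x y → ∃ λ (xs : List P₀) → ∀ z → x ≤₀ z → z ≤₀ y → z ∈ xs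

  ℓ₀ : P₀ → ℕ
  ℓ₀ nothing = 0
  ℓ₀ (just a) = ℓ a

  Word : Set
  Word = List A

  _≤*_ : Word → Word → Set
  u ≤* w = Sublist _≼_ u w

  _<*_ : Word → Word → Set
  u <* w = u ≤* w × u ≢ w

  _⋗*_ : Word → Word → Set
  w ⋗* v = v <* w × ¬ (∃ λ z → v <* z × z <* w)

  Emb : Set
  Emb = List P₀

  nonzero : Emb → Word
  nonzero [] = []
  nonzero (nothing ∷ η) = nonzero η
  nonzero (just a ∷ η) = a ∷ nonzero η

  nzPosFrom : ℕ → Emb → List ℕ
  nzPosFrom k [] = []
  nzPosFrom k (nothing ∷ η) = nzPosFrom (suc k) η
  nzPosFrom k (just _ ∷ η) = k ∷ nzPosFrom (suc k) η

  nzPos : Emb → List ℕ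
  nzPos = nzPosFrom 0

  IsEmbedding : Word → Word → Emb → Set
  IsEmbedding u w η = Pointwise _≤₀_ η (map just w) × nonzero η ≡ u

  IsRightmostEmbedding : Word → Word → Emb → Set
  IsRightmostEmbedding u w η =
    IsEmbedding u w η × (∀ η' → IsEmbedding u w η' → Pointwise _≤_ (nzPos η') (nzPos η))

  -- composition: η embedding of v in w, ε embedding of v' in v;
  -- the k-th nonzero letter of η is replaced by ε(k)
  compose : Emb → Emb → Emb
  compose [] ε = []
  compose (nothing ∷ η) ε = nothing ∷ compose η ε
  compose (just _ ∷ η) [] = nothing ∷ compose η []
  compose (just _ ∷ η) (e ∷ ε) = e ∷ compose η ε

  -- labels ⟨j , x⟩ (positions 0-based)
  Label : Set
  Label = ℕ × P₀

  _<L_ : Label → Label → Set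
  (j , x) <L (k , y) = j < k ⊎ (j ≡ k × ℓ₀ x < ℓ₀ y)

  data _≤lex_ : List Label → List Label → Set where
    []≤   : ∀ {ys} → [] ≤lex ys
    here  : ∀ {x y xs ys} → x <L y → (x ∷ xs) ≤lex (y ∷ ys)
    there : ∀ {x xs ys} → xs ≤lex ys → (x ∷ xs) ≤lex (x ∷ ys)

  data DiffAt : Emb → Emb → Label → Set where
    here  : ∀ {a b η} → a ≢ b → DiffAt (a ∷ η) (b ∷ η) (0 , b)
    there : ∀ {a η η' j x} → DiffAt η η' (j , x) → DiffAt (a ∷ η) (a ∷ η') (suc j , x)

  -- chains w = v₀ ⋗ v₁ ⋗ ... ⋗ vₙ, represented by w and [v₁ , ... , vₙ]
  data CoverChain : Word → List Word → Set where
    []  : ∀ {w} → CoverChain w []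
    _∷_ : ∀ {w v vs} → w ⋗* v → CoverChain v vs → CoverChain w (v ∷ vs)

  endpoint : Word → List Word → Word
  endpoint w [] = w
  endpoint w (v ∷ vs) = endpoint v vs

  IsMaximalChain : Word → List Word → Word → Set
  IsMaximalChain w vs u = CoverChain w vs × endpoint w vs ≡ u

  -- ChainLabels η v vs L : η is the current embedding of v in the top word,
  -- and L is the label sequence of the rest of the chain v ⋗ vs
  data ChainLabels : Emb → Word → List Word → List Label → Set where
    []   : ∀ {η v} → ChainLabels η v [] []
    step : ∀ {η v v' vs ε lab L} →
           v ⋗* v' → IsRightmostEmbedding v' v ε →
           DiffAt η (compose η ε) lab →
           ChainLabels (compose η ε) v' vs L →
           ChainLabels η v (v' ∷ vs) (lab ∷ L)

  LabelSeq : Word → List Word → List Label → Set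
  LabelSeq w vs L = ChainLabels (map just w) w vs L

  Consistent : List Label → List Label → Set
  Consistent L' L =
    L' ↭ L × (∀ i → filter (λ lab → proj₁ lab ≟ i) L' ≡ filter (λ lab → proj₁ lab ≟ i) L)

  setAt : Emb → ℕ → P₀ → Emb
  setAt [] j x = []
  setAt (a ∷ η) zero x = x ∷ η
  setAt (a ∷ η) (suc j) x = a ∷ setAt η j x

  specifiedEmbs : Emb → List Label → List Emb
  specifiedEmbs η [] = []
  specifiedEmbs η ((j , x) ∷ L) = setAt η j x ∷ specifiedEmbs (setAt η j x) L

  specifiedChain : Word → List Label → List Word
  specifiedChain w L' = map nonzero (specifiedEmbs (map just w) L')

module Submission where

-- A cover in P* changes one letter to an element it covers in P₀ (deleting it when that is 0), and the
-- rightmost embedding of the smaller word is exactly this change, except that a deleted letter is taken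
-- from the start of its run of equal letters. Hence whether a label sequence consists of cover steps,
-- and which word it reaches, depends only on its subsequences at the individual positions, which a
-- consistent permutation preserves: L′ specifies a chain of covers from w to u. Along it the rightmost
-- embeddings follow the embeddings specified by L′ until a deletion is first moved to an earlier
-- position of its run; that label is smaller than the one of L′, so L(C′) ≤lex L′.

open import Defs
open import Data.Nat using (ℕ; zero; suc; _<_; _≤_; z≤n; s≤s) renaming (_≟_ to _≟ℕ_)
open import Data.Nat.Properties using (≤-refl; ≤-trans; n≤1+n; <-irrefl; ≤-reflexive; m≤n⇒m≤1+n; suc-injective)
open import Data.List using (List; []; _∷_; map; filter; _++_; length; replicate; last)
open import Data.List.Properties using (map-++; ++-assoc; length-map; ∷-injective; ++-identityʳ; filter-accept; filter-reject)
open import Data.Maybe using (just; nothing)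
open import Data.Maybe.Properties using (just-injective)
open import Data.Product using (Σ; _×_; _,_; proj₁; proj₂; ∃)
open import Data.Empty using (⊥; ⊥-elim)
open import Data.Unit using (⊤; tt)
open import Data.Sum using (_⊎_; inj₁; inj₂)
open import Relation.Nullary using (¬_; yes; no)
open import Relation.Nullary.Decidable using (map′)
open import Relation.Binary.Definitions using (DecidableEquality)
open import Relation.Binary.Structures using (IsPartialOrder)
open import Relation.Binary.PropositionalEquality
open import Data.List.Relation.Binary.Sublist.Heterogeneous using ([]; _∷_; _∷ʳ_)
open import Data.List.Relation.Binary.Sublist.Heterogeneous.Properties using (length-mono-≤)
open import Data.List.Relation.Binary.Pointwise as Pw using (Pointwise; []; _∷_; Pointwise-length)

module Embeddings {A : Set} (_≼_ : A → A → Set) (ℓ : A → ℕ) where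
  open Setup _≼_ ℓ

  infix 4 _⊑_
  _⊑_ : Emb → Emb → Set
  _⊑_ = Pointwise _≤₀_

  nonzero-map-just : ∀ v → nonzero (map just v) ≡ v
  nonzero-map-just [] = refl
  nonzero-map-just (a ∷ v) = cong (a ∷_) (nonzero-map-just v)

  nonzero-++ : ∀ α β → nonzero (α ++ β) ≡ nonzero α ++ nonzero β
  nonzero-++ [] β = refl
  nonzero-++ (nothing ∷ α) β = nonzero-++ α β
  nonzero-++ (just a ∷ α) β = cong (a ∷_) (nonzero-++ α β)

  length-nonzero≤ : ∀ α → length (nonzero α) ≤ length α
  length-nonzero≤ [] = z≤n
  length-nonzero≤ (nothing ∷ α) = m≤n⇒m≤1+n (length-nonzero≤ α)
  length-nonzero≤ (just a ∷ α) = s≤s (length-nonzero≤ α)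

  nonzero-full : ∀ α → length (nonzero α) ≡ length α → α ≡ map just (nonzero α)
  nonzero-full [] e = refl
  nonzero-full (nothing ∷ α) e =
    ⊥-elim (<-irrefl refl (≤-trans (s≤s (≤-reflexive (sym e))) (s≤s (length-nonzero≤ α))))
  nonzero-full (just a ∷ α) e = cong (just a ∷_) (nonzero-full α (suc-injective e))

  ⊑⇒≤* : ∀ {α β} → α ⊑ β → nonzero α ≤* nonzero β
  ⊑⇒≤* [] = []
  ⊑⇒≤* (0≤ {nothing} ∷ ps) = ⊑⇒≤* ps
  ⊑⇒≤* (0≤ {just b} ∷ ps) = b ∷ʳ ⊑⇒≤* ps
  ⊑⇒≤* (j≤ p ∷ ps) = p ∷ ⊑⇒≤* ps

  ≤*⇒embedding : ∀ {u v} → u ≤* v → ∃ (IsEmbedding u v)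
  ≤*⇒embedding [] = [] , [] , refl
  ≤*⇒embedding (_ ∷ʳ s) with ≤*⇒embedding s
  ... | η , p , e = nothing ∷ η , 0≤ ∷ p , e
  ≤*⇒embedding (r ∷ s) with ≤*⇒embedding s
  ... | η , p , e = just _ ∷ η , j≤ r ∷ p , cong (_ ∷_) e

  ⊑-nonzero-injective : ∀ {α β} → α ⊑ β → nonzero α ≡ nonzero β → α ≡ β
  ⊑-nonzero-injective [] e = refl
  ⊑-nonzero-injective (0≤ {nothing} ∷ ps) e = cong (nothing ∷_) (⊑-nonzero-injective ps e)
  ⊑-nonzero-injective {nothing ∷ α} (0≤ {just b} ∷ ps) e =
    ⊥-elim (<-irrefl refl (≤-trans (≤-reflexive (sym (cong length e))) (length-mono-≤ (⊑⇒≤* ps))))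
  ⊑-nonzero-injective (j≤ p ∷ ps) e with ∷-injective e
  ... | refl , e′ = cong (_ ∷_) (⊑-nonzero-injective ps e′)

  embedding-full : ∀ {γ v} → γ ⊑ map just v → length (nonzero γ) ≡ length v → γ ≡ map just (nonzero γ)
  embedding-full {γ} {v} ps e = nonzero-full γ (trans e (sym (trans (Pointwise-length ps) (length-map just v))))

  compose-⊑ : ∀ β δ → δ ⊑ map just (nonzero β) → compose β δ ⊑ β
  compose-⊑ [] δ p = []
  compose-⊑ (nothing ∷ β) δ p = 0≤ ∷ compose-⊑ β δ p
  compose-⊑ (just b ∷ β) (d ∷ δ) (q ∷ p) = q ∷ compose-⊑ β δ p

  nonzero-compose : ∀ β δ → δ ⊑ map just (nonzero β) → nonzero (compose β δ) ≡ nonzero δ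
  nonzero-compose [] [] p = refl
  nonzero-compose (nothing ∷ β) δ p = nonzero-compose β δ p
  nonzero-compose (just b ∷ β) (nothing ∷ δ) (q ∷ p) = nonzero-compose β δ p
  nonzero-compose (just b ∷ β) (just d ∷ δ) (q ∷ p) = cong (d ∷_) (nonzero-compose β δ p)

  compose-map-just : ∀ η → compose η (map just (nonzero η)) ≡ η
  compose-map-just [] = refl
  compose-map-just (nothing ∷ η) = cong (nothing ∷_) (compose-map-just η)
  compose-map-just (just a ∷ η) = cong (just a ∷_) (compose-map-just η)

  compose-fixed : ∀ η ε → compose η ε ≡ η → length ε ≡ length (nonzero η) → ε ≡ map just (nonzero η)
  compose-fixed [] [] _ _ = refl
  compose-fixed (nothing ∷ η) ε e l = compose-fixed η ε (proj₂ (∷-injective e)) l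
  compose-fixed (just c ∷ η) (e₀ ∷ ε) e l with ∷-injective e
  ... | refl , e′ = cong (just c ∷_) (compose-fixed η ε e′ (suc-injective l))

  nonzero-split : ∀ η p a s → nonzero η ≡ p ++ a ∷ s →
    Σ Emb λ η₁ → Σ Emb λ η₂ → η ≡ η₁ ++ just a ∷ η₂ × nonzero η₁ ≡ p × nonzero η₂ ≡ s
  nonzero-split [] [] a s ()
  nonzero-split [] (_ ∷ _) a s ()
  nonzero-split (nothing ∷ η) p a s e with nonzero-split η p a s e
  ... | η₁ , η₂ , e₁ , e₂ , e₃ = nothing ∷ η₁ , η₂ , cong (nothing ∷_) e₁ , e₂ , e₃
  nonzero-split (just b ∷ η) [] a s e with ∷-injective e
  ... | refl , e′ = [] , η , refl , refl , e′
  nonzero-split (just b ∷ η) (c ∷ p) a s e with ∷-injective e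
  ... | refl , e′ with nonzero-split η p a s e′
  ... | η₁ , η₂ , e₁ , e₂ , e₃ = just b ∷ η₁ , η₂ , cong (just b ∷_) e₁ , cong (b ∷_) e₂ , e₃

  length-++-∷ : ∀ {B : Set} (p : List B) a s → length (p ++ a ∷ s) ≡ suc (length (p ++ s))
  length-++-∷ [] a s = refl
  length-++-∷ (c ∷ p) a s = cong suc (length-++-∷ p a s)

  length-<-++-∷ : ∀ {B : Set} (α : List B) b β → length α < length (α ++ b ∷ β)
  length-<-++-∷ [] b β = s≤s z≤n
  length-<-++-∷ (x ∷ α) b β = s≤s (length-<-++-∷ α b β)

  -- q₁ ⟨ x ⟩ q₂ embeds q₁ ++ x ++ q₂ into q₁ ++ a ∷ q₂ by changing the letter a to x.
  infix 6 _⟨_⟩_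
  _⟨_⟩_ : Word → P₀ → Word → Emb
  q₁ ⟨ x ⟩ q₂ = map just q₁ ++ x ∷ map just q₂

  map-just-⟨⟩ : ∀ q₁ a q₂ → map just (q₁ ++ a ∷ q₂) ≡ q₁ ⟨ just a ⟩ q₂
  map-just-⟨⟩ q₁ a q₂ = map-++ just q₁ (a ∷ q₂)

  nonzero-⟨⟩ : ∀ q₁ x q₂ → nonzero (q₁ ⟨ x ⟩ q₂) ≡ q₁ ++ nonzero (x ∷ map just q₂)
  nonzero-⟨⟩ q₁ x q₂ = trans (nonzero-++ (map just q₁) _) (cong (_++ _) (nonzero-map-just q₁))

  nonzero-⟨nothing⟩ : ∀ q₁ q₂ → nonzero (q₁ ⟨ nothing ⟩ q₂) ≡ q₁ ++ q₂
  nonzero-⟨nothing⟩ q₁ q₂ = trans (nonzero-⟨⟩ q₁ nothing q₂) (cong (q₁ ++_) (nonzero-map-just q₂))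

  nonzero-⟨just⟩ : ∀ q₁ b q₂ → nonzero (q₁ ⟨ just b ⟩ q₂) ≡ q₁ ++ b ∷ q₂
  nonzero-⟨just⟩ q₁ b q₂ = trans (nonzero-⟨⟩ q₁ (just b) q₂) (cong (λ q → q₁ ++ b ∷ q) (nonzero-map-just q₂))

  ⟨⟩-injective : ∀ q₁ {x y} q₂ → q₁ ⟨ x ⟩ q₂ ≡ q₁ ⟨ y ⟩ q₂ → x ≡ y
  ⟨⟩-injective [] q₂ e = proj₁ (∷-injective e)
  ⟨⟩-injective (a ∷ q₁) q₂ e = ⟨⟩-injective q₁ q₂ (proj₂ (∷-injective e))

  nonzero-middle : ∀ η₁ x η₂ → nonzero (η₁ ++ x ∷ η₂) ≡ nonzero (nonzero η₁ ⟨ x ⟩ nonzero η₂)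
  nonzero-middle η₁ x η₂ = begin
    nonzero (η₁ ++ x ∷ η₂)                          ≡⟨ nonzero-++ η₁ (x ∷ η₂) ⟩
    nonzero η₁ ++ nonzero (x ∷ η₂)                  ≡⟨ cong (nonzero η₁ ++_) (nonzero-∷ x) ⟩
    nonzero η₁ ++ nonzero (x ∷ map just (nonzero η₂)) ≡⟨ sym (nonzero-⟨⟩ (nonzero η₁) x (nonzero η₂)) ⟩
    nonzero (nonzero η₁ ⟨ x ⟩ nonzero η₂)           ∎
    where
    open ≡-Reasoning
    nonzero-∷ : ∀ x → nonzero (x ∷ η₂) ≡ nonzero (x ∷ map just (nonzero η₂))
    nonzero-∷ nothing = sym (nonzero-map-just _)
    nonzero-∷ (just a) = cong (a ∷_) (sym (nonzero-map-just _))

  compose-⟨⟩ : ∀ η₁ a η₂ x → compose (η₁ ++ just a ∷ η₂) (nonzero η₁ ⟨ x ⟩ nonzero η₂) ≡ η₁ ++ x ∷ η₂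
  compose-⟨⟩ [] a η₂ x = cong (x ∷_) (compose-map-just η₂)
  compose-⟨⟩ (nothing ∷ η₁) a η₂ x = cong (nothing ∷_) (compose-⟨⟩ η₁ a η₂ x)
  compose-⟨⟩ (just b ∷ η₁) a η₂ x = cong (just b ∷_) (compose-⟨⟩ η₁ a η₂ x)

  DiffAt-++ : ∀ α {a b} β → a ≢ b → DiffAt (α ++ a ∷ β) (α ++ b ∷ β) (length α , b)
  DiffAt-++ [] β ne = here ne
  DiffAt-++ (x ∷ α) β ne = there (DiffAt-++ α β ne)

  compose-⟨⟩-DiffAt : ∀ {η η₁ a η₂ p p′} x → η ≡ η₁ ++ just a ∷ η₂ → nonzero η₁ ≡ p → nonzero η₂ ≡ p′ →
    x ≢ just a → compose η (p ⟨ x ⟩ p′) ≡ η₁ ++ x ∷ η₂ × DiffAt η (compose η (p ⟨ x ⟩ p′)) (length η₁ , x) ×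
                 nonzero (compose η (p ⟨ x ⟩ p′)) ≡ nonzero (p ⟨ x ⟩ p′)
  compose-⟨⟩-DiffAt {η₁ = η₁} {a} {η₂} x refl refl refl x≢a =
    compose-⟨⟩ η₁ a η₂ x ,
    subst (λ β → DiffAt _ β _) (sym (compose-⟨⟩ η₁ a η₂ x)) (DiffAt-++ η₁ η₂ (λ e → x≢a (sym e))) ,
    trans (cong nonzero (compose-⟨⟩ η₁ a η₂ x)) (nonzero-middle η₁ x η₂)

  DiffAt⇒setAt : ∀ {α β j x} → DiffAt α β (j , x) → β ≡ setAt α j x
  DiffAt⇒setAt (here _) = refl
  DiffAt⇒setAt (there d) = cong (_ ∷_) (DiffAt⇒setAt d)

  -- Positions beyond the end read as 0.
  letterAt : Emb → ℕ → P₀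
  letterAt [] j = nothing
  letterAt (a ∷ η) zero = a
  letterAt (a ∷ η) (suc j) = letterAt η j

  letterAt-split : ∀ ζ j {a} → letterAt ζ j ≡ just a →
    Σ Emb λ ζ₁ → Σ Emb λ ζ₂ → ζ ≡ ζ₁ ++ just a ∷ ζ₂ × length ζ₁ ≡ j
  letterAt-split (b ∷ ζ) zero refl = [] , ζ , refl , refl
  letterAt-split (b ∷ ζ) (suc j) e with letterAt-split ζ j e
  ... | ζ₁ , ζ₂ , e₁ , e₂ = b ∷ ζ₁ , ζ₂ , cong (b ∷_) e₁ , cong suc e₂

  setAt-++ : ∀ α a β x → setAt (α ++ a ∷ β) (length α) x ≡ α ++ x ∷ β
  setAt-++ [] a β x = refl
  setAt-++ (y ∷ α) a β x = cong (y ∷_) (setAt-++ α a β x)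

  letterAt-setAt-≡ : ∀ ζ j x → letterAt ζ j ≢ nothing → letterAt (setAt ζ j x) j ≡ x
  letterAt-setAt-≡ [] j x ne = ⊥-elim (ne refl)
  letterAt-setAt-≡ (a ∷ ζ) zero x ne = refl
  letterAt-setAt-≡ (a ∷ ζ) (suc j) x ne = letterAt-setAt-≡ ζ j x ne

  letterAt-setAt-≢ : ∀ ζ j x i → i ≢ j → letterAt (setAt ζ j x) i ≡ letterAt ζ i
  letterAt-setAt-≢ [] j x i ne = refl
  letterAt-setAt-≢ (a ∷ ζ) zero x zero ne = ⊥-elim (ne refl)
  letterAt-setAt-≢ (a ∷ ζ) zero x (suc i) ne = refl
  letterAt-setAt-≢ (a ∷ ζ) (suc j) x zero ne = refl
  letterAt-setAt-≢ (a ∷ ζ) (suc j) x (suc i) ne = letterAt-setAt-≢ ζ j x i (λ e → ne (cong suc e))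

  length-setAt : ∀ ζ j (x : P₀) → length (setAt ζ j x) ≡ length ζ
  length-setAt [] j x = refl
  length-setAt (a ∷ ζ) zero x = refl
  length-setAt (a ∷ ζ) (suc j) x = cong suc (length-setAt ζ j x)

  letterAt-ext : ∀ α β → length α ≡ length β → (∀ i → letterAt α i ≡ letterAt β i) → α ≡ β
  letterAt-ext [] [] _ _ = refl
  letterAt-ext (a ∷ α) (b ∷ β) l h = cong₂ _∷_ (h zero) (letterAt-ext α β (suc-injective l) (λ i → h (suc i)))

  DiffAt-compose : ∀ {η β j x} ε → DiffAt η β (j , x) → compose η ε ≡ β → length ε ≡ length (nonzero η) →
    Σ Word λ q₁ → Σ A λ a → Σ Word λ q₂ →
      nonzero η ≡ q₁ ++ a ∷ q₂ × ε ≡ q₁ ⟨ x ⟩ q₂ × letterAt η j ≡ just a × x ≢ just a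
  DiffAt-compose {nothing ∷ η} ε (here ne) e l = ⊥-elim (ne (proj₁ (∷-injective e)))
  DiffAt-compose {just c ∷ η} (e₀ ∷ ε) (here ne) e l with ∷-injective e
  ... | refl , e′ = [] , c , nonzero η , refl , cong (e₀ ∷_) (compose-fixed η ε e′ (suc-injective l)) ,
                    refl , (λ q → ne (sym q))
  DiffAt-compose {nothing ∷ η} ε (there d) e l = DiffAt-compose ε d (proj₂ (∷-injective e)) l
  DiffAt-compose {just c ∷ η} (e₀ ∷ ε) (there d) e l with ∷-injective e
  ... | refl , e′ with DiffAt-compose ε d e′ (suc-injective l)
  ... | q₁ , a , q₂ , f₁ , f₂ , f₃ , f₄ = c ∷ q₁ , a , q₂ , cong (c ∷_) f₁ , cong (just c ∷_) f₂ , f₃ , f₄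

module SingleChanges {A : Set} (_≼_ : A → A → Set) (ℓ : A → ℕ)
  (po : IsPartialOrder _≡_ _≼_) (_≟_ : DecidableEquality A) where
  open Setup _≼_ ℓ
  open Embeddings _≼_ ℓ
  open IsPartialOrder po using () renaming (refl to ≼-refl; trans to ≼-trans; antisym to ≼-antisym)

  ≤₀-refl : ∀ {x} → x ≤₀ x
  ≤₀-refl {nothing} = 0≤
  ≤₀-refl {just a} = j≤ ≼-refl

  ≤₀-trans : ∀ {x y z} → x ≤₀ y → y ≤₀ z → x ≤₀ z
  ≤₀-trans 0≤ _ = 0≤
  ≤₀-trans (j≤ p) (j≤ q) = j≤ (≼-trans p q)

  ≤₀-antisym : ∀ {x y} → x ≤₀ y → y ≤₀ x → x ≡ y
  ≤₀-antisym 0≤ 0≤ = refl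
  ≤₀-antisym (j≤ p) (j≤ q) = cong just (≼-antisym p q)

  ⊑-refl : ∀ {α} → α ⊑ α
  ⊑-refl = Pw.refl ≤₀-refl

  ⊑-trans : ∀ {α β γ} → α ⊑ β → β ⊑ γ → α ⊑ γ
  ⊑-trans = Pw.transitive ≤₀-trans

  ⟨⟩-mono : ∀ q₁ {x y} q₂ → x ≤₀ y → q₁ ⟨ x ⟩ q₂ ⊑ q₁ ⟨ y ⟩ q₂
  ⟨⟩-mono q₁ q₂ p = Pw.++⁺ ⊑-refl (p ∷ ⊑-refl)

  ⟨⟩-mono⁻ : ∀ q₁ {x y} q₂ → q₁ ⟨ x ⟩ q₂ ⊑ q₁ ⟨ y ⟩ q₂ → x ≤₀ y
  ⟨⟩-mono⁻ [] q₂ (p ∷ _) = p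
  ⟨⟩-mono⁻ (a ∷ q₁) q₂ (_ ∷ ps) = ⟨⟩-mono⁻ q₁ q₂ ps

  ⊑-between-⟨⟩ : ∀ r₁ {x a} r₂ {β} → r₁ ⟨ x ⟩ r₂ ⊑ β → β ⊑ r₁ ⟨ just a ⟩ r₂ →
    Σ P₀ λ b → β ≡ r₁ ⟨ b ⟩ r₂ × x ≤₀ b × b ≤₀ just a
  ⊑-between-⟨⟩ [] r₂ (p ∷ ps) (q ∷ qs) =
    _ , cong (_ ∷_) (Pw.Pointwise-≡⇒≡ (Pw.antisymmetric ≤₀-antisym qs ps)) , p , q
  ⊑-between-⟨⟩ (c ∷ r₁) r₂ (p ∷ ps) (q ∷ qs) with ⊑-between-⟨⟩ r₁ r₂ ps qs
  ... | b , e , x≤b , b≤a = b , cong₂ _∷_ (≤₀-antisym q p) e , x≤b , b≤a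

  record _⋖₀_ (x y : P₀) : Set where
    field
      below    : x ≤₀ y
      distinct : x ≢ y
      tight    : ∀ z → x ≤₀ z → z ≤₀ y → z ≢ x → z ≢ y → ⊥

  ⋖₀-nonzero : ∀ {x y} → x ⋖₀ y → y ≢ nothing
  ⋖₀-nonzero record { below = 0≤ ; distinct = ne } refl = ne refl

  nothing⋖₀⇒minimal : ∀ {a} → nothing ⋖₀ just a → ∀ c → c ≼ a → c ≡ a
  nothing⋖₀⇒minimal {a} cov c c≼a with c ≟ a
  ... | yes c≡a = c≡a
  ... | no c≢a = ⊥-elim (_⋖₀_.tight cov (just c) 0≤ (j≤ c≼a) (λ ()) (λ { refl → c≢a refl }))

  -- Changing the letter a that follows p to x is a cover step of P*; a deletion must take the first a
  -- of its run, which is where the rightmost embedding puts the zero.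
  record CanonicalChange (p : Word) (a : A) (x : P₀) : Set where
    field
      covered   : x ⋖₀ just a
      run-start : x ≡ nothing → last p ≢ just a

  OneChange : Word → A → P₀ → ℕ → Emb → Set
  OneChange v a x n γ = Σ Word λ r₁ → Σ Word λ r₂ → γ ≡ r₁ ⟨ x ⟩ r₂ × v ≡ r₁ ++ a ∷ r₂ × n ≤ length r₁

  last-tail : ∀ {a} c (p : Word) → last (c ∷ p) ≢ just a → last p ≢ just a
  last-tail c [] _ ()
  last-tail c (d ∷ p) ne = ne

  last-shift : ∀ {a} → (∀ c → c ≼ a → c ≡ a) → ∀ c (q : Word) {s} →
    map just (c ∷ q ++ s) ⊑ map just (q ++ a ∷ s) → last (c ∷ q) ≡ just a
  last-shift minimal c [] (j≤ c≼a ∷ _) = cong just (minimal c c≼a)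
  last-shift minimal c (d ∷ q) (_ ∷ ps) = last-shift minimal d q ps

  -- A minimal letter a can only be embedded into itself, so the zero of γ must land on an a of
  -- the run starting after p.
  deletion-embedding : ∀ {a} → (∀ c → c ≼ a → c ≡ a) → ∀ p s → last p ≢ just a → ∀ γ →
    γ ⊑ map just (p ++ a ∷ s) → nonzero γ ≡ p ++ s → OneChange (p ++ a ∷ s) a nothing (length p) γ
  deletion-embedding minimal [] s _ (nothing ∷ γ) (0≤ ∷ ps) e =
    [] , s , cong (nothing ∷_) (⊑-nonzero-injective ps (trans e (sym (nonzero-map-just s)))) , refl , z≤n
  deletion-embedding minimal [] (c ∷ s) _ (just b ∷ γ) (j≤ b≼a ∷ ps) e with ∷-injective e
  ... | refl , e′ with minimal b b≼a
  ... | refl with deletion-embedding minimal [] s (λ ()) γ ps e′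
  ... | r₁ , r₂ , g , v , _ = b ∷ r₁ , r₂ , cong (just b ∷_) g , cong (b ∷_) v , z≤n
  deletion-embedding minimal (c ∷ p) s run-start (just b ∷ γ) (j≤ _ ∷ ps) e with ∷-injective e
  ... | refl , e′ with deletion-embedding minimal p s (last-tail c p run-start) γ ps e′
  ... | r₁ , r₂ , g , v , l = c ∷ r₁ , r₂ , cong (just c ∷_) g , cong (c ∷_) v , s≤s l
  deletion-embedding {a} minimal (c ∷ p) s run-start (nothing ∷ γ) (0≤ ∷ ps) e =
    ⊥-elim (run-start (last-shift minimal c p (subst (_⊑ _) γ-full ps)))
    where
    γ-full : γ ≡ map just (c ∷ p ++ s)
    γ-full = trans (embedding-full ps (trans (cong length e) (sym (length-++-∷ p a s)))) (cong (map just) e)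

  substitution-embedding : ∀ p a b p′ γ → γ ⊑ map just (p ++ a ∷ p′) → nonzero γ ≡ p ++ b ∷ p′ →
    γ ≡ p ⟨ just b ⟩ p′
  substitution-embedding p a b p′ γ ps e =
    trans (embedding-full ps same-length) (trans (cong (map just) e) (map-just-⟨⟩ p b p′))
    where
    same-length : length (nonzero γ) ≡ length (p ++ a ∷ p′)
    same-length = trans (cong length e) (trans (length-++-∷ p b p′) (sym (length-++-∷ p a p′)))

  change-embedding : ∀ {p a p′ x} → CanonicalChange p a x → ∀ γ →
    IsEmbedding (nonzero (p ⟨ x ⟩ p′)) (p ++ a ∷ p′) γ → OneChange (p ++ a ∷ p′) a x (length p) γ
  change-embedding {p} {a} {p′} {nothing} cc γ (ps , e) =
    deletion-embedding (nothing⋖₀⇒minimal (CanonicalChange.covered cc)) p p′ (CanonicalChange.run-start cc refl)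
      γ ps (trans e (nonzero-⟨nothing⟩ p p′))
  change-embedding {p} {a} {p′} {just b} cc γ (ps , e) =
    p , p′ , substitution-embedding p a b p′ γ ps (trans e (nonzero-⟨just⟩ p b p′)) , refl , ≤-refl

  ⟨⟩⊑map-just : ∀ p a p′ {x} → x ≤₀ just a → p ⟨ x ⟩ p′ ⊑ map just (p ++ a ∷ p′)
  ⟨⟩⊑map-just p a p′ x≤a = subst (_ ⊑_) (sym (map-just-⟨⟩ p a p′)) (⟨⟩-mono p p′ x≤a)

  -- A word strictly between is embedded in p ++ a ∷ p′ as some r₁ ⟨ b ⟩ r₂ with x < b < a.
  ⟨⟩-⋗* : ∀ {p a p′ x} → CanonicalChange p a x → (p ++ a ∷ p′) ⋗* nonzero (p ⟨ x ⟩ p′)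
  ⟨⟩-⋗* {p} {a} {p′} {x} cc = (result≤*v , result≢v) , no-middle
    where
    open CanonicalChange cc
    open _⋖₀_ covered
    v : Word
    v = p ++ a ∷ p′
    result⊑v : p ⟨ x ⟩ p′ ⊑ map just v
    result⊑v = ⟨⟩⊑map-just p a p′ below
    result≤*v : nonzero (p ⟨ x ⟩ p′) ≤* v
    result≤*v = subst (nonzero (p ⟨ x ⟩ p′) ≤*_) (nonzero-map-just v) (⊑⇒≤* result⊑v)
    result≢v : nonzero (p ⟨ x ⟩ p′) ≢ v
    result≢v e = distinct (⟨⟩-injective p p′
      (trans (⊑-nonzero-injective result⊑v (trans e (sym (nonzero-map-just v)))) (map-just-⟨⟩ p a p′)))
    no-middle : ¬ ∃ λ z → nonzero (p ⟨ x ⟩ p′) <* z × z <* v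
    no-middle (z , (s₁ , result≢z) , (s₂ , z≢v)) with ≤*⇒embedding s₂ | ≤*⇒embedding s₁
    ... | β , β⊑v , refl | δ , δ⊑β , eδ = strictly-between β δ β⊑v δ⊑β eδ (λ e → result≢z (sym e)) z≢v
      where
      strictly-between : ∀ β δ → β ⊑ map just v → δ ⊑ map just (nonzero β) →
        nonzero δ ≡ nonzero (p ⟨ x ⟩ p′) → nonzero β ≢ nonzero (p ⟨ x ⟩ p′) → nonzero β ≢ v → ⊥
      strictly-between β δ β⊑v δ⊑β eδ β≢result β≢v
        with change-embedding cc (compose β δ)
               (⊑-trans (compose-⊑ β δ δ⊑β) β⊑v , trans (nonzero-compose β δ δ⊑β) eδ)
      ... | r₁ , r₂ , βδ≡ , v≡ , _
        with ⊑-between-⟨⟩ r₁ r₂ (subst (_⊑ β) βδ≡ (compose-⊑ β δ δ⊑β))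
               (subst (β ⊑_) (trans (cong (map just) v≡) (map-just-⟨⟩ r₁ a r₂)) β⊑v)
      ... | b , β≡ , x≤b , b≤a = tight b x≤b b≤a b≢x b≢a
        where
        b≢x : b ≢ x
        b≢x refl = β≢result (trans (cong nonzero (trans β≡ (sym βδ≡)))
                                   (trans (nonzero-compose β δ δ⊑β) eδ))
        b≢a : b ≢ just a
        b≢a refl = β≢v (trans (cong nonzero β≡) (trans (nonzero-⟨just⟩ r₁ a r₂) (sym v≡)))

  nzPosFrom-map-just : ∀ c (q q′ : Word) → length q ≡ length q′ →
    nzPosFrom c (map just q) ≡ nzPosFrom c (map just q′)
  nzPosFrom-map-just c [] [] e = refl
  nzPosFrom-map-just c (a ∷ q) (b ∷ q′) e = cong (c ∷_) (nzPosFrom-map-just (suc c) q q′ (suc-injective e))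

  -- Moving the zero to the right moves the letters it passes one step to the left.
  nzPosFrom-⟨nothing⟩ : ∀ c r₁ r₂ p p′ → length p ≤ length r₁ → length (r₁ ++ r₂) ≡ length (p ++ p′) →
    Pointwise _≤_ (nzPosFrom c (r₁ ⟨ nothing ⟩ r₂)) (nzPosFrom c (p ⟨ nothing ⟩ p′))
  nzPosFrom-⟨nothing⟩ c [] r₂ [] p′ _ e = subst (Pointwise _≤_ _) (nzPosFrom-map-just (suc c) r₂ p′ e) (Pw.refl ≤-refl)
  nzPosFrom-⟨nothing⟩ c (a ∷ r₁) r₂ (b ∷ p) p′ (s≤s l) e =
    ≤-refl ∷ nzPosFrom-⟨nothing⟩ (suc c) r₁ r₂ p p′ l (suc-injective e)
  nzPosFrom-⟨nothing⟩ c (a ∷ r₁) r₂ [] (b ∷ p′) _ e =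
    n≤1+n c ∷ nzPosFrom-⟨nothing⟩ (suc c) r₁ r₂ [] p′ z≤n (suc-injective e)

  nzPos-⟨⟩ : ∀ x r₁ r₂ p p′ → length p ≤ length r₁ → length (r₁ ++ r₂) ≡ length (p ++ p′) →
    Pointwise _≤_ (nzPos (r₁ ⟨ x ⟩ r₂)) (nzPos (p ⟨ x ⟩ p′))
  nzPos-⟨⟩ nothing r₁ r₂ p p′ l e = nzPosFrom-⟨nothing⟩ 0 r₁ r₂ p p′ l e
  nzPos-⟨⟩ (just b) r₁ r₂ p p′ l e =
    subst₂ (λ s t → Pointwise _≤_ (nzPos s) (nzPos t)) (map-just-⟨⟩ r₁ b r₂) (map-just-⟨⟩ p b p′)
      (subst (Pointwise _≤_ _) (nzPosFrom-map-just 0 (r₁ ++ b ∷ r₂) (p ++ b ∷ p′) same-length) (Pw.refl ≤-refl))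
    where
    same-length : length (r₁ ++ b ∷ r₂) ≡ length (p ++ b ∷ p′)
    same-length = trans (length-++-∷ r₁ b r₂) (trans (cong suc e) (sym (length-++-∷ p b p′)))

  ⟨⟩-rightmost : ∀ {p a p′ x} → CanonicalChange p a x →
    IsRightmostEmbedding (nonzero (p ⟨ x ⟩ p′)) (p ++ a ∷ p′) (p ⟨ x ⟩ p′)
  ⟨⟩-rightmost {p} {a} {p′} {x} cc =
    (⟨⟩⊑map-just p a p′ (_⋖₀_.below (CanonicalChange.covered cc)) , refl) , further-left
    where
    further-left : ∀ η → IsEmbedding (nonzero (p ⟨ x ⟩ p′)) (p ++ a ∷ p′) η →
      Pointwise _≤_ (nzPos η) (nzPos (p ⟨ x ⟩ p′))
    further-left η emb with change-embedding cc η emb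
    ... | r₁ , r₂ , refl , same , l = nzPos-⟨⟩ x r₁ r₂ p p′ l
      (suc-injective (trans (sym (length-++-∷ r₁ a r₂)) (trans (cong length (sym same)) (length-++-∷ p a p′))))

  ⋗*⇒⋖₀ : ∀ q₁ a q₂ {x} → (q₁ ++ a ∷ q₂) ⋗* nonzero (q₁ ⟨ x ⟩ q₂) →
    q₁ ⟨ x ⟩ q₂ ⊑ map just (q₁ ++ a ∷ q₂) → x ≢ just a → x ⋖₀ just a
  ⋗*⇒⋖₀ q₁ a q₂ {x} (_ , no-middle) ⊑v x≢a = record { below = x≤a ; distinct = x≢a ; tight = tight }
    where
    x≤a : x ≤₀ just a
    x≤a = ⟨⟩-mono⁻ q₁ q₂ (subst (_ ⊑_) (map-just-⟨⟩ q₁ a q₂) ⊑v)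
    tight : ∀ z → x ≤₀ z → z ≤₀ just a → z ≢ x → z ≢ just a → ⊥
    tight z x≤z z≤a z≢x z≢a = no-middle (nonzero (q₁ ⟨ z ⟩ q₂) ,
      (⊑⇒≤* (⟨⟩-mono q₁ q₂ x≤z) ,
        λ e → z≢x (sym (⟨⟩-injective q₁ q₂ (⊑-nonzero-injective (⟨⟩-mono q₁ q₂ x≤z) e)))) ,
      (subst (_ ≤*_) (nonzero-⟨just⟩ q₁ a q₂) (⊑⇒≤* (⟨⟩-mono q₁ q₂ z≤a)) ,
        λ e → z≢a (⟨⟩-injective q₁ q₂
          (⊑-nonzero-injective (⟨⟩-mono q₁ q₂ z≤a) (trans e (sym (nonzero-⟨just⟩ q₁ a q₂)))))))

  trailing-run : ∀ a q → Σ Word λ p → Σ ℕ λ r → q ≡ p ++ replicate r a × last p ≢ just a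
  trailing-run a [] = [] , 0 , refl , λ ()
  trailing-run a (c ∷ q) with trailing-run a q
  ... | d ∷ p , r , e , run-start = c ∷ d ∷ p , r , cong (c ∷_) e , run-start
  ... | [] , r , e , _ with c ≟ a
  ...   | yes refl = [] , suc r , cong (c ∷_) e , λ ()
  ...   | no c≢a = c ∷ [] , r , cong (c ∷_) e , λ e′ → c≢a (just-injective e′)

  replicate-++-∷ : ∀ r (a : A) s → replicate r a ++ a ∷ s ≡ a ∷ replicate r a ++ s
  replicate-++-∷ zero a s = refl
  replicate-++-∷ (suc r) a s = cong (a ∷_) (replicate-++-∷ r a s)

  -- Moving a deletion to the start of its run of a's does not change the resulting word.
  record Canonicalisation (q₁ : Word) (a : A) (q₂ : Word) (x : P₀) : Set where
    field
      p p′        : Word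
      same-word   : q₁ ++ a ∷ q₂ ≡ p ++ a ∷ p′
      same-result : nonzero (p ⟨ x ⟩ p′) ≡ nonzero (q₁ ⟨ x ⟩ q₂)
      canonical   : CanonicalChange p a x
      moved       : (p ≡ q₁ × p′ ≡ q₂) ⊎ (Σ Word λ t → q₁ ≡ p ++ a ∷ t × p′ ≡ t ++ a ∷ q₂)

  canonicalise : ∀ q₁ a q₂ {x} → x ⋖₀ just a → Canonicalisation q₁ a q₂ x
  canonicalise q₁ a q₂ {just b} cov =
    record { p = q₁ ; p′ = q₂ ; same-word = refl ; same-result = refl
           ; canonical = record { covered = cov ; run-start = λ () } ; moved = inj₁ (refl , refl) }
  canonicalise q₁ a q₂ {nothing} cov with trailing-run a q₁
  ... | p , r , q₁≡ , run-start =
    record { p = p ; p′ = replicate r a ++ q₂ ; same-word = same-word ; same-result = same-result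
           ; canonical = record { covered = cov ; run-start = λ _ → run-start } ; moved = moved r q₁≡ }
    where
    open ≡-Reasoning
    same-word : q₁ ++ a ∷ q₂ ≡ p ++ a ∷ replicate r a ++ q₂
    same-word = begin
      q₁ ++ a ∷ q₂                   ≡⟨ cong (_++ a ∷ q₂) q₁≡ ⟩
      (p ++ replicate r a) ++ a ∷ q₂ ≡⟨ ++-assoc p (replicate r a) (a ∷ q₂) ⟩
      p ++ replicate r a ++ a ∷ q₂   ≡⟨ cong (p ++_) (replicate-++-∷ r a q₂) ⟩
      p ++ a ∷ replicate r a ++ q₂   ∎
    same-result : nonzero (p ⟨ nothing ⟩ (replicate r a ++ q₂)) ≡ nonzero (q₁ ⟨ nothing ⟩ q₂)
    same-result = begin
      nonzero (p ⟨ nothing ⟩ (replicate r a ++ q₂)) ≡⟨ nonzero-⟨nothing⟩ p _ ⟩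
      p ++ replicate r a ++ q₂                      ≡⟨ sym (++-assoc p (replicate r a) q₂) ⟩
      (p ++ replicate r a) ++ q₂                    ≡⟨ cong (_++ q₂) (sym q₁≡) ⟩
      q₁ ++ q₂                                      ≡⟨ sym (nonzero-⟨nothing⟩ q₁ q₂) ⟩
      nonzero (q₁ ⟨ nothing ⟩ q₂)                   ∎
    moved : ∀ r → q₁ ≡ p ++ replicate r a → (p ≡ q₁ × replicate r a ++ q₂ ≡ q₂) ⊎
            (Σ Word λ t → q₁ ≡ p ++ a ∷ t × replicate r a ++ q₂ ≡ t ++ a ∷ q₂)
    moved zero e = inj₁ (sym (trans e (++-identityʳ p)) , refl)
    moved (suc r) e = inj₂ (replicate r a , e , sym (replicate-++-∷ r a q₂))

module Chains {A : Set} (_≼_ : A → A → Set) (ℓ : A → ℕ)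
  (po : IsPartialOrder _≡_ _≼_) (_≟_ : DecidableEquality A) where
  open Setup _≼_ ℓ
  open Embeddings _≼_ ℓ
  open SingleChanges _≼_ ℓ po _≟_

  -- Relabelling ζ by the rightmost embedding ε either reproduces setAt ζ j x, or moves the deleted
  -- letter to an earlier position of its run.
  OwnLabel : Emb → ℕ → P₀ → Emb → Set
  OwnLabel ζ j x ε = Σ Label λ lab → DiffAt ζ (compose ζ ε) lab ×
    (lab ≡ (j , x) × compose ζ ε ≡ setAt ζ j x ⊎ lab <L (j , x) × nonzero (compose ζ ε) ≡ nonzero (setAt ζ j x))

  record CoverStep (ζ : Emb) (j : ℕ) (x : P₀) : Set where
    field
      ε         : Emb
      covers    : nonzero ζ ⋗* nonzero (setAt ζ j x)
      rightmost : IsRightmostEmbedding (nonzero (setAt ζ j x)) (nonzero ζ) ε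
      label     : ∀ η → nonzero η ≡ nonzero ζ →
                  Σ Label λ lab → DiffAt η (compose η ε) lab × nonzero (compose η ε) ≡ nonzero (setAt ζ j x)
      own-label : OwnLabel ζ j x ε

  earlier-deletion : ∀ ζ₁ a ζ₂ {p p′ t x} → x ≢ just a → nonzero ζ₁ ≡ p ++ a ∷ t → p′ ≡ t ++ a ∷ nonzero ζ₂ →
    let ζ = ζ₁ ++ just a ∷ ζ₂ in
    Σ ℕ λ k → k < length ζ₁ × DiffAt ζ (compose ζ (p ⟨ x ⟩ p′)) (k , x) ×
              nonzero (compose ζ (p ⟨ x ⟩ p′)) ≡ nonzero (p ⟨ x ⟩ p′)
  earlier-deletion ζ₁ a ζ₂ {p} {p′} {t} x≢a eζ₁ ep′ with nonzero-split ζ₁ p a t eζ₁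
  ... | θ₁ , θ₂ , refl , eθ₁ , eθ₂
    with compose-⟨⟩-DiffAt _ (++-assoc θ₁ (just a ∷ θ₂) (just a ∷ ζ₂)) eθ₁
           (trans (nonzero-++ θ₂ (just a ∷ ζ₂)) (trans (cong (_++ a ∷ nonzero ζ₂) eθ₂) (sym ep′))) x≢a
  ... | _ , d , word = length θ₁ , length-<-++-∷ θ₁ (just a) θ₂ , d , word

  cover-step-at : ∀ ζ₁ a ζ₂ {x} → x ⋖₀ just a →
    Canonicalisation (nonzero ζ₁) a (nonzero ζ₂) x → CoverStep (ζ₁ ++ just a ∷ ζ₂) (length ζ₁) x
  cover-step-at ζ₁ a ζ₂ {x} cov c = record
    { ε = p ⟨ x ⟩ p′
    ; covers = subst₂ _⋗*_ (sym word-before) (sym word-after) (⟨⟩-⋗* canonical)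
    ; rightmost = subst₂ (λ s t → IsRightmostEmbedding s t (p ⟨ x ⟩ p′)) (sym word-after) (sym word-before)
                    (⟨⟩-rightmost canonical)
    ; label = label
    ; own-label = own-label moved
    }
    where
    open Canonicalisation c
    ζ : Emb
    ζ = ζ₁ ++ just a ∷ ζ₂
    x≢a : x ≢ just a
    x≢a = _⋖₀_.distinct cov
    word-before : nonzero ζ ≡ p ++ a ∷ p′
    word-before = trans (nonzero-++ ζ₁ (just a ∷ ζ₂)) same-word
    word-after : nonzero (setAt ζ (length ζ₁) x) ≡ nonzero (p ⟨ x ⟩ p′)
    word-after = trans (cong nonzero (setAt-++ ζ₁ (just a) ζ₂ x))
                       (trans (nonzero-middle ζ₁ x ζ₂) (sym same-result))
    label : ∀ η → nonzero η ≡ nonzero ζ → Σ Label λ lab →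
      DiffAt η (compose η (p ⟨ x ⟩ p′)) lab × nonzero (compose η (p ⟨ x ⟩ p′)) ≡ nonzero (setAt ζ (length ζ₁) x)
    label η eη with nonzero-split η p a p′ (trans eη word-before)
    ... | η₁ , η₂ , e₁ , e₂ , e₃ with compose-⟨⟩-DiffAt x e₁ e₂ e₃ x≢a
    ... | _ , d , word = (length η₁ , x) , d , trans word (sym word-after)
    own-label : (p ≡ nonzero ζ₁ × p′ ≡ nonzero ζ₂) ⊎ (Σ Word λ t → nonzero ζ₁ ≡ p ++ a ∷ t × p′ ≡ t ++ a ∷ nonzero ζ₂) →
      OwnLabel ζ (length ζ₁) x (p ⟨ x ⟩ p′)
    own-label (inj₁ (e₁ , e₂)) with compose-⟨⟩-DiffAt x refl (sym e₁) (sym e₂) x≢a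
    ... | ec , d , _ = (length ζ₁ , x) , d , inj₁ (refl , trans ec (sym (setAt-++ ζ₁ (just a) ζ₂ x)))
    own-label (inj₂ (t , eζ₁ , ep′)) with earlier-deletion ζ₁ a ζ₂ x≢a eζ₁ ep′
    ... | k , k<j , d , word = (k , x) , d , inj₂ (inj₁ k<j , trans word (sym word-after))

  cover-step : ∀ ζ j x → x ⋖₀ letterAt ζ j → CoverStep ζ j x
  cover-step ζ j x cov with letterAt ζ j in eq
  ... | nothing = ⊥-elim (⋖₀-nonzero cov refl)
  ... | just a with letterAt-split ζ j eq
  ... | ζ₁ , ζ₂ , refl , refl = cover-step-at ζ₁ a ζ₂ cov (canonicalise (nonzero ζ₁) a (nonzero ζ₂) cov)

  CoverSteps : Emb → List Label → Set
  CoverSteps ζ [] = ⊤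
  CoverSteps ζ ((j , x) ∷ L) = x ⋖₀ letterAt ζ j × CoverSteps (setAt ζ j x) L

  chain-from : ∀ ζ η L → CoverSteps ζ L → nonzero η ≡ nonzero ζ →
    Σ (List Label) (ChainLabels η (nonzero ζ) (map nonzero (specifiedEmbs ζ L)))
  chain-from ζ η [] _ _ = [] , []
  chain-from ζ η ((j , x) ∷ L) (cov , steps) eη with cover-step ζ j x cov
  ... | s with CoverStep.label s η eη
  ... | lab , d , e with chain-from (setAt ζ j x) (compose η (CoverStep.ε s)) L steps e
  ... | L″ , chain = lab ∷ L″ , step (CoverStep.covers s) (CoverStep.rightmost s) d chain

  -- While the rightmost embeddings follow L the labels agree with L; at the first divergence the
  -- label is smaller, and the rest of the chain is irrelevant for ≤lex.
  chain-from-≤lex : ∀ ζ L → CoverSteps ζ L →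
    Σ (List Label) λ L″ → ChainLabels ζ (nonzero ζ) (map nonzero (specifiedEmbs ζ L)) L″ × L″ ≤lex L
  chain-from-≤lex ζ [] _ = [] , [] , []≤
  chain-from-≤lex ζ ((j , x) ∷ L) (cov , steps) with cover-step ζ j x cov
  ... | s with CoverStep.own-label s
  ... | lab , d , inj₁ (refl , e) with chain-from-≤lex (setAt ζ j x) L steps
  ...   | L″ , chain , L″≤L = (j , x) ∷ L″ ,
          step (CoverStep.covers s) (CoverStep.rightmost s) d (subst (λ η → ChainLabels η _ _ _) (sym e) chain) ,
          there L″≤L
  chain-from-≤lex ζ ((j , x) ∷ L) (cov , steps) | s | lab , d , inj₂ (lab<jx , e)
    with chain-from (setAt ζ j x) (compose ζ (CoverStep.ε s)) L steps e
  ... | L″ , chain = lab ∷ L″ , step (CoverStep.covers s) (CoverStep.rightmost s) d chain , here lab<jx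

  labels-specify-chain : ∀ {η v vs L} → ChainLabels η v vs L → nonzero η ≡ v →
    CoverSteps η L × vs ≡ map nonzero (specifiedEmbs η L)
  labels-specify-chain [] _ = tt , refl
  labels-specify-chain {η} (step {v' = v′} {vs = vs} {ε = ε} {lab = j , x} {L = L} cv ((ε⊑ , eε) , _) d chain) refl
    with DiffAt-compose ε d refl (trans (Pointwise-length ε⊑) (length-map just (nonzero η)))
  ... | q₁ , a , q₂ , f₁ , f₂ , f₃ , x≢a = (subst (x ⋖₀_) (sym f₃) cov , proj₁ rest) ,
           cong₂ _∷_ (trans (sym word) (cong nonzero η′≡)) (proj₂ rest)
    where
    η′≡ : compose η ε ≡ setAt η j x
    η′≡ = DiffAt⇒setAt d
    word : nonzero (compose η ε) ≡ v′
    word = trans (nonzero-compose η ε ε⊑) eε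
    cov : x ⋖₀ just a
    cov = ⋗*⇒⋖₀ q₁ a q₂ (subst (_⋗* _) f₁ (subst (_ ⋗*_) (trans (sym eε) (cong nonzero f₂)) cv))
            (subst₂ (λ s t → s ⊑ map just t) f₂ f₁ ε⊑) x≢a
    rest : CoverSteps (setAt η j x) L × vs ≡ map nonzero (specifiedEmbs (setAt η j x) L)
    rest = subst (λ ζ → CoverSteps ζ L × vs ≡ map nonzero (specifiedEmbs ζ L)) η′≡ (labels-specify-chain chain word)

  at : ℕ → List Label → List Label
  at i = filter (λ lab → proj₁ lab ≟ℕ i)

  DescendingFrom : P₀ → List Label → Set
  DescendingFrom y [] = ⊤
  DescendingFrom y ((_ , x) ∷ L) = x ⋖₀ y × DescendingFrom x L

  at-here : ∀ i x L → at i ((i , x) ∷ L) ≡ (i , x) ∷ at i L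
  at-here i x L = filter-accept (λ lab → proj₁ lab ≟ℕ i) refl

  at-elsewhere : ∀ i j x L → j ≢ i → at i ((j , x) ∷ L) ≡ at i L
  at-elsewhere i j x L j≢i = filter-reject (λ lab → proj₁ lab ≟ℕ i) j≢i

  CoverSteps⇒DescendingFrom : ∀ ζ L → CoverSteps ζ L → ∀ i → DescendingFrom (letterAt ζ i) (at i L)
  CoverSteps⇒DescendingFrom ζ [] _ i = tt
  CoverSteps⇒DescendingFrom ζ ((j , x) ∷ L) (cov , steps) i with j ≟ℕ i
  ... | yes refl = subst (DescendingFrom (letterAt ζ j)) (sym (at-here j x L))
        (cov , subst (λ y → DescendingFrom y (at j L)) (letterAt-setAt-≡ ζ j x (⋖₀-nonzero cov))
                     (CoverSteps⇒DescendingFrom _ L steps j))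
  ... | no j≢i = subst (DescendingFrom (letterAt ζ i)) (sym (at-elsewhere i j x L j≢i))
        (subst (λ y → DescendingFrom y (at i L)) (letterAt-setAt-≢ ζ j x i (λ e → j≢i (sym e)))
               (CoverSteps⇒DescendingFrom _ L steps i))

  DescendingFrom⇒CoverSteps : ∀ ζ L → (∀ i → DescendingFrom (letterAt ζ i) (at i L)) → CoverSteps ζ L
  DescendingFrom⇒CoverSteps ζ [] _ = tt
  DescendingFrom⇒CoverSteps ζ ((j , x) ∷ L) desc = proj₁ desc-j , DescendingFrom⇒CoverSteps (setAt ζ j x) L desc′
    where
    desc-j : x ⋖₀ letterAt ζ j × DescendingFrom x (at j L)
    desc-j = subst (DescendingFrom (letterAt ζ j)) (at-here j x L) (desc j)
    desc′ : ∀ i → DescendingFrom (letterAt (setAt ζ j x) i) (at i L)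
    desc′ i with i ≟ℕ j
    ... | yes refl = subst (λ y → DescendingFrom y (at i L))
                       (sym (letterAt-setAt-≡ ζ j x (⋖₀-nonzero (proj₁ desc-j)))) (proj₂ desc-j)
    ... | no i≢j = subst (λ y → DescendingFrom y (at i L)) (sym (letterAt-setAt-≢ ζ j x i i≢j))
                     (subst (DescendingFrom _) (at-elsewhere i j x L (λ e → i≢j (sym e))) (desc i))

  final : Emb → List Label → Emb
  final ζ [] = ζ
  final ζ ((j , x) ∷ L) = final (setAt ζ j x) L

  lastLetter : P₀ → List Label → P₀
  lastLetter y [] = y
  lastLetter y ((_ , x) ∷ L) = lastLetter x L

  letterAt-final : ∀ ζ L → CoverSteps ζ L → ∀ i → letterAt (final ζ L) i ≡ lastLetter (letterAt ζ i) (at i L)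
  letterAt-final ζ [] _ i = refl
  letterAt-final ζ ((j , x) ∷ L) (cov , steps) i with j ≟ℕ i
  ... | yes refl = trans (letterAt-final _ L steps j)
          (trans (cong (λ y → lastLetter y (at j L)) (letterAt-setAt-≡ ζ j x (⋖₀-nonzero cov)))
                 (cong (lastLetter (letterAt ζ j)) (sym (at-here j x L))))
  ... | no j≢i = trans (letterAt-final _ L steps i)
          (trans (cong (λ y → lastLetter y (at i L)) (letterAt-setAt-≢ ζ j x i (λ e → j≢i (sym e))))
                 (cong (lastLetter (letterAt ζ i)) (sym (at-elsewhere i j x L j≢i))))

  length-final : ∀ ζ L → length (final ζ L) ≡ length ζ
  length-final ζ [] = refl
  length-final ζ ((j , x) ∷ L) = trans (length-final _ L) (length-setAt ζ j x)

  final-positionwise : ∀ ζ L L′ → CoverSteps ζ L → CoverSteps ζ L′ → (∀ i → at i L′ ≡ at i L) →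
    final ζ L′ ≡ final ζ L
  final-positionwise ζ L L′ steps steps′ same =
    letterAt-ext _ _ (trans (length-final ζ L′) (sym (length-final ζ L))) λ i → begin
      letterAt (final ζ L′) i               ≡⟨ letterAt-final ζ L′ steps′ i ⟩
      lastLetter (letterAt ζ i) (at i L′)    ≡⟨ cong (lastLetter (letterAt ζ i)) (same i) ⟩
      lastLetter (letterAt ζ i) (at i L)     ≡⟨ sym (letterAt-final ζ L steps i) ⟩
      letterAt (final ζ L) i                ∎
    where open ≡-Reasoning

  endpoint-specified : ∀ ζ L {v} → nonzero ζ ≡ v → endpoint v (map nonzero (specifiedEmbs ζ L)) ≡ nonzero (final ζ L)
  endpoint-specified ζ [] e = sym e
  endpoint-specified ζ ((j , x) ∷ L) _ = endpoint-specified (setAt ζ j x) L refl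

lemma3p1 : (A : Set) (_≼_ : A → A → Set) (ℓ : A → ℕ) →
    IsPartialOrder _≡_ _≼_ →
    let open Setup _≼_ ℓ in
    NaturalLabeling → LocallyFinite →
    (u w : Word) (vs : List Word) (L L' : List Label) →
    IsMaximalChain w vs u →
    LabelSeq w vs L →
    Consistent L' L →
    Σ (List Label) (λ L'' →
      LabelSeq w (specifiedChain w L') L'' ×
      L'' ≤lex L' ×
      endpoint w (specifiedChain w L') ≡ u)
lemma3p1 A _≼_ ℓ po (_ , ℓ-injective , _) _ u w vs L L′ (_ , ends-at-u) labels (_ , same-at) =
  proj₁ result , chain , proj₂ (proj₂ result) , ends
  where
  open Setup _≼_ ℓ
  open Embeddings _≼_ ℓ
  open Chains _≼_ ℓ po (λ a b → map′ (ℓ-injective a b) (cong ℓ) (ℓ a ≟ℕ ℓ b))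
  ω : Emb
  ω = map just w
  w-word : nonzero ω ≡ w
  w-word = nonzero-map-just w
  specified : CoverSteps ω L × vs ≡ specifiedChain w L
  specified = labels-specify-chain labels w-word
  steps′ : CoverSteps ω L′
  steps′ = DescendingFrom⇒CoverSteps ω L′ λ i →
    subst (DescendingFrom _) (sym (same-at i)) (CoverSteps⇒DescendingFrom ω L (proj₁ specified) i)
  result : Σ (List Label) λ L″ → ChainLabels ω (nonzero ω) (specifiedChain w L′) L″ × L″ ≤lex L′
  result = chain-from-≤lex ω L′ steps′
  chain : LabelSeq w (specifiedChain w L′) (proj₁ result)
  chain = subst (λ v → ChainLabels ω v (specifiedChain w L′) (proj₁ result)) w-word (proj₁ (proj₂ result))
  ends : endpoint w (specifiedChain w L′) ≡ u
  ends = begin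
    endpoint w (specifiedChain w L′) ≡⟨ endpoint-specified ω L′ w-word ⟩
    nonzero (final ω L′)             ≡⟨ cong nonzero (final-positionwise ω L L′ (proj₁ specified) steps′ same-at) ⟩
    nonzero (final ω L)              ≡⟨ sym (endpoint-specified ω L w-word) ⟩
    endpoint w (specifiedChain w L)  ≡⟨ cong (endpoint w) (sym (proj₂ specified)) ⟩
    endpoint w vs                    ≡⟨ ends-at-u ⟩
    u                                ∎
    where open ≡-Reasoning
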